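{- Let $\mathcal{A}$ be a finite alphabet. Every balanced standard episturmian sequence over $\mathcal{A}$ containing at least three distinct letters is ultimately periodic. In particular, if $|\mathcal{A}|\ge3$, no $\mathcal{A}$-strict episturmian sequence (Arnoux–Rauzy sequence) over $\mathcal{A}$ is balanced.
   Context: For a finite word $w$, $w^{(+)}$ denotes the shortest palindrome having $w$ as a prefix. For an infinite word $\Delta=x_1x_2\cdots$ set $u_1=\varepsilon$, $u_{n+1}=(u_nx_n)^{(+)}$. An infinite word $s$ is standard episturmian if there exists an infinite word $\Delta$ (a directive sequence of $s$) such that every $u_n$ is a prefix of $s$. An infinite word $t$ is episturmian if its set of factors equals the set of factors of some standard episturmian sequence. A standard episturmian sequence $s$ (or any episturmian sequence with the same set of factors) is $\mathcal{A}$-strict if every letter of $\mathcal{A}$ occurs in $s$ and occurs infinitely often in the directive sequence $\Delta(s)$. A word is balanced if for any two factors $u,v$ of the same length and every letter $a$, $||u|_a-|v|_a|\le1$. An infinite word $w$ is ultimately periodic if there are $n\ge1$ and $\ell$ with $w_i=w_{i+n}$ for all $i\ge\ell$. -}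

module Defs where

open import Data.Nat using (ℕ; zero; suc; _+_; _≤_; _<_; ∣_-_∣)
open import Data.Fin using (Fin; _≟_)
open import Data.List using (List; []; _∷_; _++_; [_]; reverse; length)
open import Data.Product using (Σ; ∃; ∃-syntax; _×_; _,_)
open import Relation.Binary.PropositionalEquality using (_≡_; _≢_)
open import Relation.Nullary using (yes; no)
open import Function.Bundles using (_⇔_)

InfWord : ℕ → Set
InfWord k = ℕ → Fin k

IsPalindrome : {A : Set} → List A → Set
IsPalindrome w = w ≡ reverse w

IsPrefix : {A : Set} → List A → List A → Set
IsPrefix u w = ∃[ v ] (w ≡ u ++ v)

IsPalClosure : {A : Set} → List A → List A → Set
IsPalClosure w p =
  IsPalindrome p × IsPrefix w p ×
  (∀ q → IsPalindrome q → IsPrefix w q → length p ≤ length q)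

window : {k : ℕ} → InfWord k → ℕ → ℕ → List (Fin k)
window s i zero = []
window s i (suc n) = s i ∷ window s (suc i) n

IsPrefixInf : {k : ℕ} → List (Fin k) → InfWord k → Set
IsPrefixInf w s = w ≡ window s 0 (length w)

IsFactor : {k : ℕ} → List (Fin k) → InfWord k → Set
IsFactor w s = ∃[ i ] (w ≡ window s i (length w))

-- Δ is a directive sequence of s: with u₁ = ε, u_{n+1} = (u_n x_n)^(+),
-- every u_n is a prefix of s.  (u is indexed from 0 here: u 0 = ε.)
IsDirective : {k : ℕ} → InfWord k → InfWord k → Set
IsDirective {k} Δ s =
  Σ (ℕ → List (Fin k)) λ u →
    (u 0 ≡ []) ×
    (∀ n → IsPalClosure (u n ++ [ Δ n ]) (u (suc n))) ×
    (∀ n → IsPrefixInf (u n) s)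

StandardEpisturmian : {k : ℕ} → InfWord k → Set
StandardEpisturmian s = ∃[ Δ ] IsDirective Δ s

SameFactors : {k : ℕ} → InfWord k → InfWord k → Set
SameFactors t s = ∀ w → (IsFactor w t ⇔ IsFactor w s)

Episturmian : {k : ℕ} → InfWord k → Set
Episturmian t = ∃[ s ] (StandardEpisturmian s × SameFactors t s)

Occurs : {k : ℕ} → Fin k → InfWord k → Set
Occurs a s = ∃[ i ] (s i ≡ a)

OccursInfinitelyOften : {k : ℕ} → Fin k → InfWord k → Set
OccursInfinitelyOften a Δ = ∀ N → ∃[ m ] (N ≤ m × Δ m ≡ a)

StrictStandardEpisturmian : {k : ℕ} → InfWord k → Set
StrictStandardEpisturmian {k} s =
  ∃[ Δ ] (IsDirective Δ s ×
          (∀ (a : Fin k) → Occurs a s) ×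
          (∀ (a : Fin k) → OccursInfinitelyOften a Δ))

StrictEpisturmian : {k : ℕ} → InfWord k → Set
StrictEpisturmian t = ∃[ s ] (StrictStandardEpisturmian s × SameFactors t s)

count : {k : ℕ} → Fin k → List (Fin k) → ℕ
count a [] = 0
count a (b ∷ w) with a ≟ b
... | yes _ = suc (count a w)
... | no _ = count a w

Balanced : {k : ℕ} → InfWord k → Set
Balanced {k} s = ∀ u v → IsFactor u s → IsFactor v s → length u ≡ length v →
  ∀ (a : Fin k) → ∣ count a u - count a v ∣ ≤ 1

UltimatelyPeriodic : {k : ℕ} → InfWord k → Set
UltimatelyPeriodic s = ∃[ n ] ∃[ ℓ ] (1 ≤ n × (∀ i → ℓ ≤ i → s i ≡ s (i + n)))

AtLeastThreeLetters : {k : ℕ} → InfWord k → Set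
AtLeastThreeLetters {k} s = ∃[ a ] ∃[ b ] ∃[ c ]
  (a ≢ b × a ≢ c × b ≢ c × Occurs a s × Occurs b s × Occurs c s)

-- The palindromic prefixes u n of s obey Justin's formula: u (n+1) = u n Δ n u n when the letter Δ n is
-- fresh (absent from Δ 0 ⋯ Δ (n-1)), and |u (n+1)| = 2|u n| - |u j| for the previous occurrence j of Δ n
-- otherwise. So a fresh letter x = Δ i that recurs gives the factor x (u i) x, while next to a later fresh
-- letter, or to a later return of the initial letter Δ 0, one reads a factor of the same length without x;
-- balance forbids both. Since s has three letters, some letter is fresh after the first change of Δ, and a
-- case analysis on first occurrences then shows that Δ stays constant once it repeats a letter; by the
-- pigeonhole principle on the k letters this happens within k steps. With Δ constant from N on, the gaps
-- |u (n+1)| - |u n| are constant and s is periodic from |u N| on. In an 𝒜-strict word at least two letters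
-- recur infinitely often in Δ, so it cannot be balanced.

module Submission where

open import Defs
open import Data.Nat using (ℕ; zero; suc; _+_; _∸_; _≤_; _<_; z≤n; s≤s; z<s; s<s; s≤s⁻¹; _<?_; ∣_-_∣)
open import Data.Nat.Properties hiding (_≟_)
open import Data.Nat.Induction using (<-rec)
open import Data.Nat.Tactic.RingSolver using (solve-∀)
open import Data.Fin as Fin using (Fin; _≟_; toℕ)
open import Data.Fin.Properties using (pigeonhole; toℕ<n)
open import Data.List using (List; []; _∷_; _++_; [_]; reverse; length)
open import Data.List.Properties
  using (∷-injective; ++-assoc; ++-cancelˡ; length-++; reverse-++; reverse-involutive; length-reverse)
open import Data.Sum using (_⊎_; inj₁; inj₂)
open import Data.Empty using (⊥; ⊥-elim)
open import Data.Product using (∃-syntax; _×_; _,_; proj₁; proj₂)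
open import Function.Bundles using (Equivalence)
open import Relation.Binary.PropositionalEquality hiding ([_])
open import Relation.Nullary using (¬_; Dec; yes; no; contradiction)
open import Relation.Nullary.Decidable using (_×-dec_; ¬?; decidable-stable)
open import Function using (_∘_; flip)
open import Relation.Unary using (Decidable)
open import Relation.Binary.Definitions using (tri<; tri≈; tri>)

private
  variable
    k : ℕ

least-witness : {P : ℕ → Set} → Decidable P → ∀ {n} → P n → ∃[ m ] P m × (∀ {i} → i < m → ¬ P i)
least-witness {P} P? {n} = <-rec (λ n → P n → ∃[ m ] P m × (∀ {i} → i < m → ¬ P i)) step n
  where
  step : ∀ n → (∀ {m} → m < n → P m → ∃[ m′ ] P m′ × (∀ {i} → i < m′ → ¬ P i)) →
         P n → ∃[ m ] P m × (∀ {i} → i < m → ¬ P i)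
  step n rec pn with anyUpTo? P? n
  ... | yes (m , m<n , pm) = rec m<n pm
  ... | no none = n , pn , λ i<n pi → none (_ , i<n , pi)

window-length : (s : InfWord k) (i n : ℕ) → length (window s i n) ≡ n
window-length s i zero    = refl
window-length s i (suc n) = cong suc (window-length s (suc i) n)

window-cong : (s t : InfWord k) (i j n : ℕ) → (∀ {m} → m < n → s (i + m) ≡ t (j + m)) →
              window s i n ≡ window t j n
window-cong s t i j zero    eq = refl
window-cong s t i j (suc n) eq = cong₂ _∷_
  (subst₂ (λ a b → s a ≡ t b) (+-identityʳ i) (+-identityʳ j) (eq z<s))
  (window-cong s t (suc i) (suc j) n λ {m} m<n →
    subst₂ (λ a b → s a ≡ t b) (+-suc i m) (+-suc j m) (eq (s<s m<n)))

window-cong⁻¹ : (s t : InfWord k) (i j n : ℕ) → window s i n ≡ window t j n →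
                ∀ {m} → m < n → s (i + m) ≡ t (j + m)
window-cong⁻¹ s t i j (suc n) eq {zero} _ =
  subst₂ (λ a b → s a ≡ t b) (sym (+-identityʳ i)) (sym (+-identityʳ j)) (proj₁ (∷-injective eq))
window-cong⁻¹ s t i j (suc n) eq {suc m} (s<s m<n) =
  subst₂ (λ a b → s a ≡ t b) (sym (+-suc i m)) (sym (+-suc j m))
    (window-cong⁻¹ s t (suc i) (suc j) n (proj₂ (∷-injective eq)) m<n)

window-shift : (s : InfWord k) (i n : ℕ) → window s i n ≡ window (λ m → s (i + m)) 0 n
window-shift s i n = window-cong s (λ m → s (i + m)) i 0 n λ _ → refl

window-++ : (s : InfWord k) (i m n : ℕ) → window s i (m + n) ≡ window s i m ++ window s (i + m) n
window-++ s i zero    n = cong (λ j → window s j n) (sym (+-identityʳ i))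
window-++ s i (suc m) n = cong (s i ∷_)
  (trans (window-++ s (suc i) m n) (cong (λ j → window s (suc i) m ++ window s j n) (sym (+-suc i m))))

window-snoc : (s : InfWord k) (i n : ℕ) → window s i (suc n) ≡ window s i n ++ [ s (i + n) ]
window-snoc s i n = trans (cong (window s i) (+-comm 1 n)) (window-++ s i n 1)

window-isPrefix : (s : InfWord k) {m n : ℕ} → m ≤ n → IsPrefix (window s 0 m) (window s 0 n)
window-isPrefix s {m} {n} m≤n =
  window s m (n ∸ m) , trans (cong (window s 0) (sym (m+[n∸m]≡n m≤n))) (window-++ s 0 m (n ∸ m))

window-reverse : (s : InfWord k) (n : ℕ) → reverse (window s 0 n) ≡ window (λ m → s (n ∸ suc m)) 0 n
window-reverse s zero    = refl
window-reverse s (suc n) = begin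
  reverse (window s 0 (suc n))               ≡⟨ cong reverse (window-snoc s 0 n) ⟩
  reverse (window s 0 n ++ [ s n ])          ≡⟨ reverse-++ (window s 0 n) [ s n ] ⟩
  s n ∷ reverse (window s 0 n)               ≡⟨ cong (s n ∷_) (window-reverse s n) ⟩
  s n ∷ window (λ m → s (n ∸ suc m)) 0 n     ≡⟨ cong (s n ∷_) (window-shift (λ m → s (suc n ∸ suc m)) 1 n) ⟨
  window (λ m → s (suc n ∸ suc m)) 0 (suc n) ∎
  where open ≡-Reasoning

PalindromeAt : InfWord k → ℕ → ℕ → Set
PalindromeAt s i n = ∀ p q → suc (p + q) ≡ n → s (i + p) ≡ s (i + q)

module _ (s : InfWord k) (n : ℕ) where

  isPalindrome⇒palindromePrefix : IsPalindrome (window s 0 n) → PalindromeAt s 0 n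
  isPalindrome⇒palindromePrefix pal p q 1+p+q≡n = trans
    (window-cong⁻¹ s (λ m → s (n ∸ suc m)) 0 0 n (trans pal (window-reverse s n)) p<n)
    (cong s (trans (cong (_∸ suc p) (sym 1+p+q≡n)) (m+n∸m≡n (suc p) q)))
    where
    p<n : p < n
    p<n = subst (p <_) 1+p+q≡n (s≤s (m≤m+n p q))

  palindromePrefix⇒isPalindrome : PalindromeAt s 0 n → IsPalindrome (window s 0 n)
  palindromePrefix⇒isPalindrome pal = trans
    (window-cong s (λ m → s (n ∸ suc m)) 0 0 n (λ {m} m<n → pal m (n ∸ suc m) (m+[n∸m]≡n m<n)))
    (sym (window-reverse s n))

palindromeAt⇒isPalindrome : (s : InfWord k) (i n : ℕ) → PalindromeAt s i n → IsPalindrome (window s i n)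
palindromeAt⇒isPalindrome s i n pal = subst IsPalindrome (sym (window-shift s i n))
  (palindromePrefix⇒isPalindrome (λ m → s (i + m)) n pal)

palindromeAt-sandwich : (s : InfWord k) (i n : ℕ) → s i ≡ s (suc i + n) →
                        PalindromeAt s (suc i) n → PalindromeAt s i (2 + n)
palindromeAt-sandwich s i n ends inner zero q e with suc-injective e
... | refl = trans (cong s (+-identityʳ i)) (trans ends (cong s (sym (+-suc i n))))
palindromeAt-sandwich s i n ends inner (suc p) zero e =
  sym (palindromeAt-sandwich s i n ends inner zero (suc p) (trans (cong suc (+-comm 0 (suc p))) e))
palindromeAt-sandwich s i n ends inner (suc p) (suc q) e =
  subst₂ (λ a b → s a ≡ s b) (sym (+-suc i p)) (sym (+-suc i q))
    (inner p q (trans (sym (+-suc p q)) (suc-injective (suc-injective e))))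

palindromeAt-copy : (s : InfWord k) (i n : ℕ) → (∀ {t} → t < n → s (i + t) ≡ s t) →
                    PalindromeAt s 0 n → PalindromeAt s i n
palindromeAt-copy s i n copy pal p q e =
  trans (copy (subst (p <_) e (s≤s (m≤m+n p q))))
        (trans (pal p q e) (sym (copy (subst (q <_) e (s≤s (m≤n+m q p))))))

module _ (c : Fin k) where

  count-++ : ∀ xs ys → count c (xs ++ ys) ≡ count c xs + count c ys
  count-++ []       ys = refl
  count-++ (x ∷ xs) ys with c ≟ x
  ... | yes _ = cong suc (count-++ xs ys)
  ... | no  _ = count-++ xs ys

  count-here : ∀ {x} xs → c ≡ x → count c (x ∷ xs) ≡ suc (count c xs)
  count-here {x} xs c≡x with c ≟ x
  ... | yes _   = refl
  ... | no  c≢x = contradiction c≡x c≢x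

  count-there : ∀ {x} xs → c ≢ x → count c (x ∷ xs) ≡ count c xs
  count-there {x} xs c≢x with c ≟ x
  ... | yes c≡x = contradiction c≡x c≢x
  ... | no  _   = refl

  count-window-absent : (s : InfWord k) (i n : ℕ) → (∀ {m} → m < n → s (i + m) ≢ c) →
                        count c (window s i n) ≡ 0
  count-window-absent s i zero    absent = refl
  count-window-absent s i (suc n) absent = trans
    (count-there _ λ c≡si → absent z<s (trans (cong s (+-identityʳ i)) (sym c≡si)))
    (count-window-absent s (suc i) n λ {m} m<n → absent (s<s m<n) ∘ trans (cong s (+-suc i m)))

  count-window-++ : (s : InfWord k) (i m n : ℕ) →
                    count c (window s i (m + n)) ≡ count c (window s i m) + count c (window s (i + m) n)
  count-window-++ s i m n = trans (cong (count c) (window-++ s i m n)) (count-++ (window s i m) _)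

  count-window-snoc : (s : InfWord k) (i n : ℕ) → s (i + n) ≡ c →
                      count c (window s i (suc n)) ≡ suc (count c (window s i n))
  count-window-snoc s i n sᵢ₊ₙ≡c = begin
    count c (window s i (suc n))      ≡⟨ cong (count c) (window-snoc s i n) ⟩
    count c (w ++ [ s (i + n) ])      ≡⟨ count-++ w _ ⟩
    count c w + count c [ s (i + n) ] ≡⟨ cong (count c w +_) (count-here [] (sym sᵢ₊ₙ≡c)) ⟩
    count c w + 1                     ≡⟨ +-comm _ 1 ⟩
    suc (count c w)                   ∎
    where
    open ≡-Reasoning
    w = window s i n

  count-window-snoc-absent : (s : InfWord k) (i n : ℕ) → c ≢ s (i + n) →
                             count c (window s i (suc n)) ≡ count c (window s i n)
  count-window-snoc-absent s i n c≢sᵢ₊ₙ = begin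
    count c (window s i (suc n))      ≡⟨ cong (count c) (window-snoc s i n) ⟩
    count c (w ++ [ s (i + n) ])      ≡⟨ count-++ w _ ⟩
    count c w + count c [ s (i + n) ] ≡⟨ cong (count c w +_) (count-there [] c≢sᵢ₊ₙ) ⟩
    count c w + 0                     ≡⟨ +-identityʳ _ ⟩
    count c w                         ∎
    where
    open ≡-Reasoning
    w = window s i n

  count-window-sandwich : (s : InfWord k) (i n : ℕ) → s i ≡ c → s (suc i + n) ≡ c →
                          count c (window s i (2 + n)) ≡ 2 + count c (window s (suc i) n)
  count-window-sandwich s i n sᵢ≡c sⱼ≡c =
    trans (count-here _ (sym sᵢ≡c)) (cong suc (count-window-snoc s (suc i) n sⱼ≡c))

  count-gap-2⇒unbalanced : (s : InfWord k) (i j n x : ℕ) →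
    count c (window s i n) ≡ 2 + x → count c (window s j n) ≡ x → ¬ Balanced s
  count-gap-2⇒unbalanced s i j n x countᵢ countⱼ balanced = contradiction 2≤1 λ { (s≤s ()) }
    where
    factor : ∀ i → IsFactor (window s i n) s
    factor i = i , cong (window s i) (sym (window-length s i n))
    equal-length : length (window s i n) ≡ length (window s j n)
    equal-length = trans (window-length s i n) (sym (window-length s j n))
    open ≤-Reasoning
    2≤1 : 2 ≤ 1
    2≤1 = begin
      2                                                      ≡⟨ m+n∸n≡m 2 x ⟨
      2 + x ∸ x                                              ≤⟨ m∸n≤∣m-n∣ (2 + x) x ⟩
      ∣ 2 + x - x ∣                                          ≡⟨ cong₂ ∣_-_∣ countᵢ countⱼ ⟨
      ∣ count c (window s i n) - count c (window s j n) ∣    ≤⟨ balanced _ _ (factor i) (factor j) equal-length c ⟩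
      1                                                      ∎

Fresh : {A : Set} → (ℕ → A) → ℕ → Set
Fresh Δ n = ∀ {i} → i < n → Δ i ≢ Δ n

Recurs : {A : Set} → (ℕ → A) → ℕ → Set
Recurs Δ i = ∃[ j ] i < j × Δ j ≡ Δ i

EventuallyConstant : InfWord k → Set
EventuallyConstant Δ = ∃[ N ] ∀ {n} → N ≤ n → Δ n ≡ Δ N

first-occurrence : (Δ : InfWord k) (n : ℕ) → ∃[ i ] i ≤ n × Δ i ≡ Δ n × Fresh Δ i
first-occurrence Δ n with least-witness (λ i → Δ i ≟ Δ n) {n} refl
... | i , Δi≡Δn , below =
  i , ≮⇒≥ (λ n<i → below n<i refl) , Δi≡Δn , λ j<i Δj≡Δi → below j<i (trans Δj≡Δi Δi≡Δn)

initial-block-bound : (Δ : InfWord k) {r i : ℕ} → (∀ {t} → t < r → Δ t ≡ Δ 0) → Δ i ≢ Δ 0 → r ≤ i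
initial-block-bound Δ initial-block Δi≢Δ₀ = ≮⇒≥ (Δi≢Δ₀ ∘ initial-block)

avoid-two : {P : Fin k → Set} {α β γ : Fin k} → α ≢ β → α ≢ γ → β ≢ γ → P α → P β → P γ →
            ∀ a b → ∃[ x ] P x × x ≢ a × x ≢ b
avoid-two {α = α} {β} {γ} α≢β α≢γ β≢γ Pα Pβ Pγ a b with α ≟ a | α ≟ b
... | no α≢a  | no α≢b  = α , Pα , α≢a , α≢b
... | yes refl | _ with β ≟ b
...   | no β≢b   = β , Pβ , α≢β ∘ sym , β≢b
...   | yes refl = γ , Pγ , α≢γ ∘ sym , β≢γ ∘ sym
avoid-two {α = α} {β} {γ} α≢β α≢γ β≢γ Pα Pβ Pγ a b | no _ | yes refl with β ≟ a
...   | no β≢a   = β , Pβ , β≢a , α≢β ∘ sym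
...   | yes refl = γ , Pγ , β≢γ ∘ sym , α≢γ ∘ sym

-- A return is an occurrence of the initial letter Δ 0 after position 0. The three hypotheses are the
-- configurations that balance rules out.
module Stabilisation (Δ : InfWord k) {r : ℕ}
  (initial-block : ∀ {t} → t < r → Δ t ≡ Δ 0) (Δr≢Δ₀ : Δ r ≢ Δ 0)
  (recurring⇒no-later-fresh : ∀ {i m} → Fresh Δ i → Δ i ≢ Δ 0 → Recurs Δ i → i < m → ¬ Fresh Δ m)
  (recurring⇒no-later-return : ∀ {i q} → Fresh Δ i → Δ i ≢ Δ 0 → Recurs Δ i → i < q → Δ q ≢ Δ 0)
  (returns⇒no-later-fresh : ∀ {p q m} → r < p → p < q → Δ p ≡ Δ 0 → Δ q ≡ Δ 0 → p < m → ¬ Fresh Δ m)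
  where

  distinct-recurring : ∀ {i₀ i₁ j₀ j₁} → Fresh Δ i₀ → Fresh Δ i₁ → Δ i₀ ≢ Δ i₁ →
                       i₀ < j₀ → Δ j₀ ≡ Δ i₀ → i₁ < j₁ → Δ j₁ ≡ Δ i₁ → i₀ < j₁ → i₁ < j₀ → ⊥
  distinct-recurring {i₀} {i₁} {j₀} {j₁} fresh₀ fresh₁ Δi₀≢Δi₁ i₀<j₀ Δj₀≡Δi₀ i₁<j₁ Δj₁≡Δi₁ i₀<j₁ i₁<j₀ =
    by-cases (Δ i₀ ≟ Δ 0) (Δ i₁ ≟ Δ 0)
    where
    recurs₀ : Recurs Δ i₀
    recurs₀ = j₀ , i₀<j₀ , Δj₀≡Δi₀
    recurs₁ : Recurs Δ i₁
    recurs₁ = j₁ , i₁<j₁ , Δj₁≡Δi₁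
    by-cases : Dec (Δ i₀ ≡ Δ 0) → Dec (Δ i₁ ≡ Δ 0) → ⊥
    by-cases (yes Δi₀≡a) (yes Δi₁≡a) = Δi₀≢Δi₁ (trans Δi₀≡a (sym Δi₁≡a))
    by-cases (yes Δi₀≡a) (no  Δi₁≢a) = recurring⇒no-later-return fresh₁ Δi₁≢a recurs₁ i₁<j₀ (trans Δj₀≡Δi₀ Δi₀≡a)
    by-cases (no  Δi₀≢a) (yes Δi₁≡a) = recurring⇒no-later-return fresh₀ Δi₀≢a recurs₀ i₀<j₁ (trans Δj₁≡Δi₁ Δi₁≡a)
    by-cases (no  Δi₀≢a) (no  Δi₁≢a) with <-cmp i₀ i₁
    ... | tri< i₀<i₁ _ _ = recurring⇒no-later-fresh fresh₀ Δi₀≢a recurs₀ i₀<i₁ fresh₁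
    ... | tri≈ _ refl _  = Δi₀≢Δi₁ refl
    ... | tri> _ _ i₁<i₀ = recurring⇒no-later-fresh fresh₁ Δi₁≢a recurs₁ i₁<i₀ fresh₀

  plateau⇒no-later-fresh : ∀ {i m} → r ≤ i → Δ (suc i) ≡ Δ i → i < m → ¬ Fresh Δ m
  plateau⇒no-later-fresh {i} r≤i plateau i<m with Δ i ≟ Δ 0 | first-occurrence Δ i
  ... | yes Δi≡a | _ = returns⇒no-later-fresh r<i (n<1+n i) Δi≡a (trans plateau Δi≡a) i<m
    where
    r<i : r < i
    r<i = ≤∧≢⇒< r≤i λ { refl → Δr≢Δ₀ Δi≡a }
  ... | no Δi≢a | i₀ , i₀≤i , Δi₀≡Δi , fresh₀ =
    recurring⇒no-later-fresh fresh₀ (Δi≢a ∘ trans (sym Δi₀≡Δi))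
      (suc i , s≤s i₀≤i , trans plateau (sym Δi₀≡Δi)) (≤-<-trans i₀≤i i<m)

  plateau⇒constant : ∀ {i} → r ≤ i → Δ (suc i) ≡ Δ i → ∀ {n} → i ≤ n → Δ n ≡ Δ i
  plateau⇒constant {i} r≤i plateau {n} i≤n with Δ n ≟ Δ i
  ... | yes Δn≡Δi = Δn≡Δi
  ... | no Δn≢Δi with first-occurrence Δ n | first-occurrence Δ i
  ...   | i₁ , i₁≤n , Δi₁≡Δn , fresh₁ | i₀ , i₀≤i , Δi₀≡Δi , fresh₀ =
    ⊥-elim (distinct-recurring fresh₀ fresh₁ (λ e → Δn≢Δi (trans (sym Δi₁≡Δn) (trans (sym e) Δi₀≡Δi)))
      (s≤s i₀≤i) (trans plateau (sym Δi₀≡Δi)) i₁<n (sym Δi₁≡Δn) (≤-<-trans i₀≤i i<n) (<-trans i₁<i (n<1+n i)))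
    where
    i<n : i < n
    i<n = ≤∧≢⇒< i≤n λ { refl → Δn≢Δi refl }
    i₁<n : i₁ < n
    i₁<n = ≤∧≢⇒< i₁≤n λ { refl → plateau⇒no-later-fresh r≤i plateau i<n fresh₁ }
    i₁<i : i₁ < i
    i₁<i = ≤∧≢⇒< (≮⇒≥ λ i<i₁ → plateau⇒no-later-fresh r≤i plateau i<i₁ fresh₁)
                 λ { refl → Δn≢Δi (sym Δi₁≡Δn) }

  change⇒fresh : ∀ {i} → Δ (suc i) ≢ Δ i → Δ (suc i) ≢ Δ 0 → Fresh Δ (suc i)
  change⇒fresh {i} change Δ[1+i]≢a with first-occurrence Δ (suc i)
  ... | i₁ , i₁≤1+i , Δi₁≡Δ[1+i] , fresh₁ with m≤n⇒m<n∨m≡n i₁≤1+i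
  ...   | inj₂ refl   = fresh₁
  ...   | inj₁ i₁<1+i =
    ⊥-elim (earlier-first-occurrence (≤∧≢⇒< (s≤s⁻¹ i₁<1+i) λ { refl → change (sym Δi₁≡Δ[1+i]) }))
    where
    recurs₁ : Recurs Δ i₁
    recurs₁ = suc i , i₁<1+i , sym Δi₁≡Δ[1+i]
    earlier-first-occurrence : i₁ < i → ⊥
    earlier-first-occurrence i₁<i with first-occurrence Δ i
    ... | i₀ , i₀≤i , Δi₀≡Δi , fresh₀ with m≤n⇒m<n∨m≡n i₀≤i
    ...   | inj₂ refl =
      recurring⇒no-later-fresh fresh₁ (Δ[1+i]≢a ∘ trans (sym Δi₁≡Δ[1+i])) recurs₁ i₁<i fresh₀
    ...   | inj₁ i₀<i =
      distinct-recurring fresh₀ fresh₁ (λ e → change (trans (sym Δi₁≡Δ[1+i]) (trans (sym e) Δi₀≡Δi)))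
        i₀<i (sym Δi₀≡Δi) i₁<1+i (sym Δi₁≡Δ[1+i]) (<-trans i₀<i (n<1+n i)) i₁<i

  module _ (change : ∀ {t} → t < k → Δ (suc (r + t)) ≢ Δ (r + t)) where

    return-or-fresh : ∀ {j} → j < k → Δ (suc (r + j)) ≡ Δ 0 ⊎ Fresh Δ (suc (r + j))
    return-or-fresh {j} j<k with Δ (suc (r + j)) ≟ Δ 0
    ... | yes Δ≡a = inj₁ Δ≡a
    ... | no  Δ≢a = inj₂ (change⇒fresh (change j<k) Δ≢a)

    distinct-after-r : ∀ {i j} → i < j → j ≤ k → Δ (r + i) ≢ Δ (r + j)
    distinct-after-r {i} {suc j} (s≤s i≤j) j<k Δ≡ with return-or-fresh j<k
    ... | inj₂ fresh = fresh (s≤s (+-monoʳ-≤ r i≤j)) (trans Δ≡ (cong Δ (+-suc r j)))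
    ... | inj₁ Δq≡a with i
    ...   | zero   = Δr≢Δ₀ (trans (cong Δ (sym (+-identityʳ r)))
                              (trans Δ≡ (trans (cong Δ (+-suc r j)) Δq≡a)))
    ...   | suc i′ = returns⇒no-later-fresh (m<m+n r z<s) (s≤s (+-monoʳ-≤ r i≤j)) Δp≡a Δq≡a
                       (n<1+n (r + suc i′)) (change⇒fresh (change i<k) (change i<k ∘ flip trans (sym Δp≡a)))
      where
      Δp≡a : Δ (r + suc i′) ≡ Δ 0
      Δp≡a = trans Δ≡ (trans (cong Δ (+-suc r j)) Δq≡a)
      i<k : suc i′ < k
      i<k = <-≤-trans (s≤s i≤j) j<k

  eventually-constant : EventuallyConstant Δ
  eventually-constant with anyUpTo? (λ t → Δ (suc (r + t)) ≟ Δ (r + t)) k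
  ... | yes (t , _ , plateau) = r + t , plateau⇒constant (m≤m+n r t) plateau
  ... | no no-plateau with pigeonhole (n<1+n k) (λ u → Δ (r + toℕ u))
  ...   | u , v , u<v , Δu≡Δv = ⊥-elim
    (distinct-after-r (λ t<k plateau → no-plateau (_ , t<k , plateau)) u<v (s≤s⁻¹ (toℕ<n v)) Δu≡Δv)

module Directive (s Δ : InfWord k) (u : ℕ → List (Fin k)) (u₀ : u 0 ≡ [])
                 (closure : ∀ n → IsPalClosure (u n ++ [ Δ n ]) (u (suc n)))
                 (prefix : ∀ n → IsPrefixInf (u n) s) where

  ℓ : ℕ → ℕ
  ℓ n = length (u n)

  ℓ₀ : ℓ 0 ≡ 0
  ℓ₀ = cong length u₀

  u-isPalindrome : ∀ n → IsPalindrome (u n)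
  u-isPalindrome zero    = subst IsPalindrome (sym u₀) refl
  u-isPalindrome (suc n) = proj₁ (closure n)

  u-palindrome : ∀ n → PalindromeAt s 0 (ℓ n)
  u-palindrome n = isPalindrome⇒palindromePrefix s (ℓ n) (subst IsPalindrome (prefix n) (u-isPalindrome n))

  u-extension : ∀ n → ∃[ v ] u (suc n) ≡ u n ++ Δ n ∷ v
  u-extension n with proj₁ (proj₂ (closure n))
  ... | v , eq = v , trans eq (++-assoc (u n) [ Δ n ] v)

  gap : ℕ → ℕ
  gap n = length (proj₁ (u-extension n))

  ℓ-suc : ∀ n → ℓ (suc n) ≡ suc (ℓ n + gap n)
  ℓ-suc n = trans (cong length (proj₂ (u-extension n))) (trans (length-++ (u n)) (+-suc (ℓ n) (gap n)))

  s[ℓ]≡Δ : ∀ n → s (ℓ n) ≡ Δ n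
  s[ℓ]≡Δ n = proj₁ (∷-injective (++-cancelˡ (u n) _ _ (begin
    u n ++ window s (ℓ n) (suc (gap n))           ≡⟨ cong (_++ window s (ℓ n) (suc (gap n))) (prefix n) ⟩
    window s 0 (ℓ n) ++ window s (ℓ n) (suc (gap n)) ≡⟨ window-++ s 0 (ℓ n) (suc (gap n)) ⟨
    window s 0 (ℓ n + suc (gap n))                ≡⟨ cong (window s 0) (trans (+-suc _ _) (sym (ℓ-suc n))) ⟩
    window s 0 (ℓ (suc n))                        ≡⟨ prefix (suc n) ⟨
    u (suc n)                                     ≡⟨ proj₂ (u-extension n) ⟩
    u n ++ Δ n ∷ proj₁ (u-extension n)            ∎)))
    where open ≡-Reasoning

  u-snoc : ∀ n → u n ++ [ Δ n ] ≡ window s 0 (suc (ℓ n))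
  u-snoc n = trans (cong₂ _++_ (prefix n) (cong [_] (sym (s[ℓ]≡Δ n)))) (sym (window-snoc s 0 (ℓ n)))

  ℓ-<-suc : ∀ n → ℓ n < ℓ (suc n)
  ℓ-<-suc n = subst (ℓ n <_) (sym (ℓ-suc n)) (s≤s (m≤m+n (ℓ n) (gap n)))

  ℓ-strictMono : ∀ {i j} → i < j → ℓ i < ℓ j
  ℓ-strictMono {i} {suc j} (s≤s i≤j) with m≤n⇒m<n∨m≡n i≤j
  ... | inj₁ i<j  = <-trans (ℓ-strictMono i<j) (ℓ-<-suc j)
  ... | inj₂ refl = ℓ-<-suc i

  ℓ-mono : ∀ {i j} → i ≤ j → ℓ i ≤ ℓ j
  ℓ-mono i≤j with m≤n⇒m<n∨m≡n i≤j
  ... | inj₁ i<j  = <⇒≤ (ℓ-strictMono i<j)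
  ... | inj₂ refl = ≤-refl

  ℓ-cancel-< : ∀ {i j} → ℓ i < ℓ j → i < j
  ℓ-cancel-< ℓi<ℓj = ≰⇒> λ j≤i → <⇒≱ ℓi<ℓj (ℓ-mono j≤i)

  n≤ℓ : ∀ n → n ≤ ℓ n
  n≤ℓ zero    = z≤n
  n≤ℓ (suc n) = <-≤-trans (s≤s (n≤ℓ n)) (ℓ-<-suc n)

  ℓ-bracket : ∀ {j q} → ℓ j ≤ q → ∃[ i ] j ≤ i × ℓ i ≤ q × q < ℓ (suc i)
  ℓ-bracket {j} {q} ℓj≤q with least-witness (λ m → q <? ℓ (suc (j + m))) q<ℓ
    where
    q<ℓ : q < ℓ (suc (j + q))
    q<ℓ = <-≤-trans (s≤s (m≤n+m q j)) (n≤ℓ (suc (j + q)))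
  ... | m , q<ℓ , below = j + m , m≤m+n j m , ℓ[j+m]≤q m below , q<ℓ
    where
    ℓ[j+m]≤q : ∀ m → (∀ {i} → i < m → ¬ q < ℓ (suc (j + i))) → ℓ (j + m) ≤ q
    ℓ[j+m]≤q zero    _     = subst (λ i → ℓ i ≤ q) (sym (+-identityʳ j)) ℓj≤q
    ℓ[j+m]≤q (suc m) below = subst (λ i → ℓ i ≤ q) (sym (+-suc j m)) (≮⇒≥ (below (n<1+n m)))

  -- p w (reverse p) is a palindrome with prefix u n Δ n.
  closure-gap-bound : ∀ n p w → u n ++ [ Δ n ] ≡ p ++ w → IsPalindrome w → gap n ≤ length p
  closure-gap-bound n p w split w-pal = +-cancelˡ-≤ (ℓ n) (gap n) (length p) (s≤s⁻¹ (begin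
    suc (ℓ n + gap n)                           ≡⟨ ℓ-suc n ⟨
    ℓ (suc n)                                   ≤⟨ proj₂ (proj₂ (closure n)) q q-palindrome (reverse p , refl) ⟩
    length q                                    ≡⟨ length-++ (u n ++ [ Δ n ]) ⟩
    length (u n ++ [ Δ n ]) + length (reverse p) ≡⟨ cong₂ _+_ (length-++ (u n)) (length-reverse p) ⟩
    ℓ n + 1 + length p                          ≡⟨ cong (_+ length p) (+-comm (ℓ n) 1) ⟩
    suc (ℓ n + length p)                        ∎))
    where
    q : List (Fin k)
    q = (u n ++ [ Δ n ]) ++ reverse p
    q-palindrome : IsPalindrome q
    q-palindrome = begin
      (u n ++ [ Δ n ]) ++ reverse p            ≡⟨ cong (_++ reverse p) split ⟩
      (p ++ w) ++ reverse p                    ≡⟨ ++-assoc p w (reverse p) ⟩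
      p ++ w ++ reverse p                      ≡⟨ cong (λ v → p ++ v ++ reverse p) w-pal ⟩
      p ++ reverse w ++ reverse p              ≡⟨ cong (_++ reverse w ++ reverse p) (reverse-involutive p) ⟨
      reverse (reverse p) ++ reverse w ++ reverse p ≡⟨ cong (reverse (reverse p) ++_) (reverse-++ p w) ⟨
      reverse (reverse p) ++ reverse (p ++ w)  ≡⟨ reverse-++ (p ++ w) (reverse p) ⟨
      reverse ((p ++ w) ++ reverse p)          ≡⟨ cong (λ v → reverse (v ++ reverse p)) split ⟨
      reverse q                                ∎
      where open ≡-Reasoning
    open ≤-Reasoning

  closure-gap-bound-at : ∀ n {i m} → i + m ≡ suc (ℓ n) → PalindromeAt s i m → gap n ≤ i
  closure-gap-bound-at n {i} {m} i+m≡ pal = subst (gap n ≤_) (window-length s 0 i)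
    (closure-gap-bound n (window s 0 i) (window s i m) split (palindromeAt⇒isPalindrome s i m pal))
    where
    split : u n ++ [ Δ n ] ≡ window s 0 i ++ window s i m
    split = trans (u-snoc n) (trans (cong (window s 0) (sym i+m≡)) (window-++ s 0 i m))

  gap≤ℓ : ∀ n → gap n ≤ ℓ n
  gap≤ℓ n = closure-gap-bound n (u n) [ Δ n ] refl refl

  palindromePrefix⇒ℓ : ∀ {L} → PalindromeAt s 0 L → ∃[ j ] ℓ j ≡ L
  palindromePrefix⇒ℓ {zero}  _   = 0 , ℓ₀
  palindromePrefix⇒ℓ {suc L} pal with ℓ-bracket {0} {L} (subst (_≤ L) (sym ℓ₀) z≤n)
  ... | j , _ , ℓj≤L , L<ℓ[1+j] = suc j , ≤-antisym ℓ[1+j]≤1+L L<ℓ[1+j]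
    where
    is-prefix : IsPrefix (u j ++ [ Δ j ]) (window s 0 (suc L))
    is-prefix = subst (λ v → IsPrefix v (window s 0 (suc L))) (sym (u-snoc j))
                      (window-isPrefix s (s≤s ℓj≤L))
    ℓ[1+j]≤1+L : ℓ (suc j) ≤ suc L
    ℓ[1+j]≤1+L = subst (ℓ (suc j) ≤_) (window-length s 0 (suc L))
      (proj₂ (proj₂ (closure j)) _ (palindromePrefix⇒isPalindrome s (suc L) pal) is-prefix)

  -- Reflecting through u n, u (n+1) and u n shows the prefix of length ℓ n - gap n - 1 is a palindrome,
  -- hence some u j.
  earlier-occurrence : ∀ n → gap n < ℓ n → ∃[ j ] Δ j ≡ Δ n × suc (gap n + ℓ j) ≡ ℓ n
  earlier-occurrence n g<ℓ with m≤n⇒∃[o]m+o≡n g<ℓ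
  ... | e , 1+g+e≡ℓ with palindromePrefix⇒ℓ e-palindrome
    where
    g = gap n
    mirror : ∀ p q → suc (p + q) ≡ e → suc (p + (g + suc q)) ≡ ℓ n
    mirror p q 1+p+q≡e = trans (arith p q g) (trans (cong (λ x → suc (g + x)) 1+p+q≡e) 1+g+e≡ℓ)
      where
      arith : ∀ p q g → suc (p + (g + suc q)) ≡ suc (g + suc (p + q))
      arith = solve-∀
    mirror′ : ∀ p q → suc (p + q) ≡ e → suc ((g + suc q) + (g + suc p)) ≡ ℓ (suc n)
    mirror′ p q 1+p+q≡e = trans (arith p q g)
      (trans (cong (λ x → suc (suc (g + x) + g)) 1+p+q≡e)
             (trans (cong (λ x → suc (x + g)) 1+g+e≡ℓ) (sym (ℓ-suc n))))
      where
      arith : ∀ p q g → suc ((g + suc q) + (g + suc p)) ≡ suc (suc (g + suc (p + q)) + g)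
      arith = solve-∀
    e-palindrome : PalindromeAt s 0 e
    e-palindrome p q 1+p+q≡e = begin
      s p           ≡⟨ u-palindrome n p (g + suc q) (mirror p q 1+p+q≡e) ⟩
      s (g + suc q) ≡⟨ u-palindrome (suc n) (g + suc q) (g + suc p) (mirror′ p q 1+p+q≡e) ⟩
      s (g + suc p) ≡⟨ u-palindrome n q (g + suc p) (mirror q p (trans (cong suc (+-comm q p)) 1+p+q≡e)) ⟨
      s q           ∎
      where open ≡-Reasoning
  ... | j , ℓj≡e = j , Δj≡Δn , trans (cong (λ x → suc (gap n + x)) ℓj≡e) 1+g+e≡ℓ
    where
    open ≡-Reasoning
    Δj≡Δn : Δ j ≡ Δ n
    Δj≡Δn = begin
      Δ j          ≡⟨ s[ℓ]≡Δ j ⟨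
      s (ℓ j)      ≡⟨ cong s ℓj≡e ⟩
      s e          ≡⟨ u-palindrome n e (gap n) (trans (cong suc (+-comm e (gap n))) 1+g+e≡ℓ) ⟩
      s (gap n)    ≡⟨ u-palindrome (suc n) (gap n) (ℓ n) (trans (cong suc (+-comm (gap n) (ℓ n))) (sym (ℓ-suc n))) ⟩
      s (ℓ n)      ≡⟨ s[ℓ]≡Δ n ⟩
      Δ n          ∎

  fresh⇒gap≡ℓ : ∀ {n} → Fresh Δ n → gap n ≡ ℓ n
  fresh⇒gap≡ℓ {n} fresh = ≤-antisym (gap≤ℓ n) (≮⇒≥ λ g<ℓ → no-earlier (earlier-occurrence n g<ℓ))
    where
    no-earlier : ¬ (∃[ j ] Δ j ≡ Δ n × suc (gap n + ℓ j) ≡ ℓ n)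
    no-earlier (j , Δj≡Δn , 1+g+ℓj≡ℓn) =
      fresh (ℓ-cancel-< (subst (ℓ j <_) 1+g+ℓj≡ℓn (s≤s (m≤n+m (ℓ j) (gap n))))) Δj≡Δn

  u-suffix : ∀ {i j d} → ℓ j ≡ ℓ i + d → ∀ {t} → t < ℓ i → s (d + t) ≡ s t
  u-suffix {i} {j} {d} ℓj≡ℓi+d {t} t<ℓi with m≤n⇒∃[o]m+o≡n t<ℓi
  ... | e , 1+t+e≡ℓi = trans (u-palindrome j (d + t) e 1+d+t+e≡ℓj) (sym (u-palindrome i t e 1+t+e≡ℓi))
    where
    arith : ∀ d t e → suc (d + t + e) ≡ suc (t + e) + d
    arith = solve-∀
    1+d+t+e≡ℓj : suc (d + t + e) ≡ ℓ j
    1+d+t+e≡ℓj = trans (arith d t e) (trans (cong (_+ d) 1+t+e≡ℓi) (sym ℓj≡ℓi+d))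

  ℓ-split : ∀ {i j} → i < j → ∃[ d ] ℓ j ≡ ℓ i + suc d
  ℓ-split {i} i<j with m≤n⇒∃[o]m+o≡n (ℓ-strictMono i<j)
  ... | d , 1+ℓi+d≡ℓj = d , trans (sym 1+ℓi+d≡ℓj) (sym (+-suc (ℓ i) d))

  u-mirror : ∀ {i j d} → ℓ j ≡ ℓ i + suc d → s d ≡ Δ i
  u-mirror {i} {j} {d} ℓj≡ = trans (u-palindrome j d (ℓ i) 1+d+ℓi≡ℓj) (s[ℓ]≡Δ i)
    where
    1+d+ℓi≡ℓj : suc (d + ℓ i) ≡ ℓ j
    1+d+ℓi≡ℓj = trans (cong suc (+-comm d (ℓ i))) (trans (sym (+-suc (ℓ i) d)) (sym ℓj≡))

  u-suffix-end : ∀ {i j d} → ℓ j ≡ ℓ i + d → s (d + ℓ i) ≡ Δ j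
  u-suffix-end {i} {j} {d} ℓj≡ = trans (cong s (trans (+-comm d (ℓ i)) (sym ℓj≡))) (s[ℓ]≡Δ j)

  -- Justin's formula: Δ n (u j) Δ n is a palindromic suffix of u n Δ n, and a shorter gap would give an
  -- occurrence of Δ n strictly between j and n.
  repeat-gap : ∀ {j n} → j < n → Δ j ≡ Δ n → (∀ {i} → j < i → i < n → Δ i ≢ Δ n) →
               ℓ n ≡ suc (ℓ j + gap n)
  repeat-gap {j} {n} j<n Δj≡Δn last with ℓ-split j<n
  ... | d , ℓn≡ = trans ℓn≡ (trans (+-suc (ℓ j) d) (cong (λ x → suc (ℓ j + x)) (≤-antisym d≤gap gap≤d)))
    where
    x-uj-x : PalindromeAt s d (2 + ℓ j)
    x-uj-x = palindromeAt-sandwich s d (ℓ j) (trans (u-mirror ℓn≡) (trans Δj≡Δn (sym (u-suffix-end ℓn≡))))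
      (palindromeAt-copy s (suc d) (ℓ j) (u-suffix ℓn≡) (u-palindrome j))
    gap≤d : gap n ≤ d
    gap≤d = closure-gap-bound-at n (trans (arith d (ℓ j)) (cong suc (sym ℓn≡))) x-uj-x
      where
      arith : ∀ d l → d + (2 + l) ≡ suc (l + suc d)
      arith = solve-∀
    d≤gap : d ≤ gap n
    d≤gap = ≮⇒≥ λ gap<d → later-occurrence gap<d (earlier-occurrence n (<-trans gap<d d<ℓn))
      where
      d<ℓn : d < ℓ n
      d<ℓn = subst (d <_) (sym ℓn≡) (m≤n+m (suc d) (ℓ j))
      later-occurrence : gap n < d → ¬ (∃[ j′ ] Δ j′ ≡ Δ n × suc (gap n + ℓ j′) ≡ ℓ n)
      later-occurrence gap<d (j′ , Δj′≡Δn , 1+g+ℓj′≡ℓn) =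
        last (ℓ-cancel-< ℓj<ℓj′) (ℓ-cancel-< (subst (ℓ j′ <_) 1+g+ℓj′≡ℓn (s≤s (m≤n+m (ℓ j′) (gap n)))))
             Δj′≡Δn
        where
        ℓj<ℓj′ : ℓ j < ℓ j′
        ℓj<ℓj′ = +-cancelˡ-< (gap n) (ℓ j) (ℓ j′) (begin-strict
          gap n + ℓ j   ≡⟨ +-comm (gap n) (ℓ j) ⟩
          ℓ j + gap n   <⟨ +-monoʳ-< (ℓ j) gap<d ⟩
          ℓ j + d       ≡⟨ suc-injective (trans (sym (+-suc (ℓ j) d)) (trans (sym ℓn≡) (sym 1+g+ℓj′≡ℓn))) ⟩
          gap n + ℓ j′  ∎)
          where open ≤-Reasoning

  twin-gap-copy : ∀ {j n} → ℓ n ≡ suc (ℓ j + gap n) → ∀ {t} → t ≤ gap n → s (ℓ n + t) ≡ s (ℓ j + t)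
  twin-gap-copy {j} {n} ℓn≡ {t} t≤g with m≤n⇒∃[o]m+o≡n t≤g
  ... | e , t+e≡g = trans
    (u-palindrome (suc n) (ℓ n + t) e
      (trans (arith (ℓ n) t e) (trans (cong (λ x → suc (ℓ n + x)) t+e≡g) (sym (ℓ-suc n)))))
    (u-palindrome n e (ℓ j + t)
      (trans (arith′ (ℓ j) t e) (trans (cong (λ x → suc (ℓ j + x)) t+e≡g) (sym ℓn≡))))
    where
    arith : ∀ a t e → suc (a + t + e) ≡ suc (a + (t + e))
    arith = solve-∀
    arith′ : ∀ a t e → suc (e + (a + t)) ≡ suc (a + (t + e))
    arith′ = solve-∀

  upper-half-mirror : ∀ n {p} → ℓ n < p → p < ℓ (suc n) → ∃[ e ] e < ℓ n × s e ≡ s p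
  upper-half-mirror n {p} ℓn<p p<ℓ[1+n] with m≤n⇒∃[o]m+o≡n p<ℓ[1+n]
  ... | e , 1+p+e≡ℓ = e , <-≤-trans e<g (gap≤ℓ n) , sym (u-palindrome (suc n) p e 1+p+e≡ℓ)
    where
    e<g : e < gap n
    e<g = +-cancelˡ-< (ℓ n) e (gap n) (begin-strict
      ℓ n + e     <⟨ +-monoˡ-< e ℓn<p ⟩
      p + e       ≡⟨ suc-injective (trans 1+p+e≡ℓ (ℓ-suc n)) ⟩
      ℓ n + gap n ∎)
      where open ≤-Reasoning

  letter-in-Δ : ∀ n {p} → p < ℓ n → ∃[ j ] j < n × Δ j ≡ s p
  letter-in-Δ zero {p} p<ℓ₀ = contradiction (subst (p <_) ℓ₀ p<ℓ₀) λ ()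
  letter-in-Δ (suc n) {p} p<ℓ[1+n] with <-cmp p (ℓ n)
  ... | tri< p<ℓn _ _ = let j , j<n , Δj≡sp = letter-in-Δ n p<ℓn in j , m<n⇒m<1+n j<n , Δj≡sp
  ... | tri≈ _ refl _ = n , n<1+n n , sym (s[ℓ]≡Δ n)
  ... | tri> _ _ ℓn<p =
    let e , e<ℓn , se≡sp = upper-half-mirror n ℓn<p p<ℓ[1+n]
        j , j<n , Δj≡se  = letter-in-Δ n e<ℓn
    in j , m<n⇒m<1+n j<n , trans Δj≡se se≡sp

  occurs⇒in-Δ : ∀ {x} → Occurs x s → ∃[ j ] Δ j ≡ x
  occurs⇒in-Δ (p , sp≡x) =
    let j , _ , Δj≡sp = letter-in-Δ (suc p) (<-≤-trans (n<1+n p) (n≤ℓ (suc p))) in j , trans Δj≡sp sp≡x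

  fresh-absent : ∀ {i} → Fresh Δ i → ∀ {p} → p < ℓ i → s p ≢ Δ i
  fresh-absent {i} fresh p<ℓi sp≡Δi =
    let j , j<i , Δj≡sp = letter-in-Δ i p<ℓi in fresh j<i (trans Δj≡sp sp≡Δi)

  s₀ : s 0 ≡ Δ 0
  s₀ = subst (λ i → s i ≡ Δ 0) ℓ₀ (s[ℓ]≡Δ 0)

  ℓ₁ : ℓ 1 ≡ 1
  ℓ₁ = trans (ℓ-suc 0) (cong suc (trans (cong (ℓ 0 +_) (fresh⇒gap≡ℓ λ ())) (cong (λ x → x + x) ℓ₀)))

  s₁ : s 1 ≡ Δ 1
  s₁ = subst (λ i → s i ≡ Δ 1) ℓ₁ (s[ℓ]≡Δ 1)

  repeat-step : ∀ {n} → Δ (suc n) ≡ Δ n → ℓ (suc n) ≡ suc (ℓ n + gap (suc n))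
  repeat-step {n} rep = repeat-gap (n<1+n n) (sym rep) λ n<i i<1+n _ → <⇒≱ i<1+n n<i

  repeat⇒gap-suc : ∀ {n} → Δ (suc n) ≡ Δ n → gap (suc n) ≡ gap n
  repeat⇒gap-suc {n} rep = +-cancelˡ-≡ (ℓ n) _ _ (suc-injective (trans (sym (repeat-step rep)) (ℓ-suc n)))

  eventually-constant⇒ultimately-periodic : EventuallyConstant Δ → UltimatelyPeriodic s
  eventually-constant⇒ultimately-periodic (N , constant) = period , ℓ N , s≤s z≤n , periodic
    where
    period = suc (gap N)

    tail-repeat : ∀ {n} → N ≤ n → Δ (suc n) ≡ Δ n
    tail-repeat N≤n = trans (constant (m≤n⇒m≤1+n N≤n)) (sym (constant N≤n))

    tail-gap : ∀ {n} → N ≤ n → gap n ≡ gap N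
    tail-gap {zero}  z≤n    = refl
    tail-gap {suc n} N≤1+n with m≤n⇒m<n∨m≡n N≤1+n
    ... | inj₂ refl         = refl
    ... | inj₁ (s≤s N≤n)    = trans (repeat⇒gap-suc (tail-repeat N≤n)) (tail-gap N≤n)

    tail-step : ∀ {n} → N ≤ n → ℓ (suc n) ≡ ℓ n + period
    tail-step {n} N≤n =
      trans (ℓ-suc n) (trans (cong (λ g → suc (ℓ n + g)) (tail-gap N≤n)) (sym (+-suc (ℓ n) (gap N))))

    tail-copy : ∀ {n t} → N ≤ n → t < period → s (ℓ (suc n) + t) ≡ s (ℓ n + t)
    tail-copy {n} N≤n t<P = twin-gap-copy (repeat-step (tail-repeat N≤n))
      (subst (_ ≤_) (sym (tail-gap (m≤n⇒m≤1+n N≤n))) (s≤s⁻¹ t<P))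

    periodic : ∀ i → ℓ N ≤ i → s i ≡ s (i + period)
    periodic i ℓN≤i with ℓ-bracket ℓN≤i
    ... | m , N≤m , ℓm≤i , i<ℓ[1+m] with m≤n⇒∃[o]m+o≡n ℓm≤i
    ...   | t , refl = begin
      s (ℓ m + t)                ≡⟨ tail-copy N≤m t<P ⟨
      s (ℓ (suc m) + t)          ≡⟨ cong (λ x → s (x + t)) (tail-step N≤m) ⟩
      s (ℓ m + period + t)       ≡⟨ cong s (+-comm-middle (ℓ m) period t) ⟩
      s (ℓ m + t + period)       ∎
      where
      open ≡-Reasoning
      +-comm-middle : ∀ a b c → a + b + c ≡ a + c + b
      +-comm-middle = solve-∀
      t<P : t < period
      t<P = +-cancelˡ-< (ℓ m) t period (subst (ℓ m + t <_) (tail-step N≤m) i<ℓ[1+m])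

  fresh-doubling : ∀ {m} → Fresh Δ m → ∀ {t} → t < ℓ m → s (suc (ℓ m + t)) ≡ s t
  fresh-doubling {m} fresh = u-suffix (trans (ℓ-suc m)
    (trans (cong (λ g → suc (ℓ m + g)) (fresh⇒gap≡ℓ fresh)) (sym (+-suc (ℓ m) (ℓ m)))))

  fresh-count-in-copy : ∀ {i d} → Fresh Δ i → (∀ {t} → t < ℓ i → s (d + t) ≡ s t) →
                        count (Δ i) (window s d (ℓ i)) ≡ 0
  fresh-count-in-copy {i} fresh copy = count-window-absent (Δ i) s _ (ℓ i)
    λ t<ℓi → fresh-absent fresh t<ℓi ∘ trans (sym (copy t<ℓi))

  fresh-recurring⇒x-u-x : ∀ {i} → Fresh Δ i → Recurs Δ i → ∃[ P ] count (Δ i) (window s P (2 + ℓ i)) ≡ 2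
  fresh-recurring⇒x-u-x {i} fresh (j , i<j , Δj≡Δi) with ℓ-split i<j
  ... | d , ℓj≡ = d , trans
    (count-window-sandwich (Δ i) s d (ℓ i) (u-mirror ℓj≡) (trans (u-suffix-end ℓj≡) Δj≡Δi))
    (cong (2 +_) (fresh-count-in-copy fresh (u-suffix ℓj≡)))

  -- Here Δ starts with a^r b, so u r = a^r; a return of a yields the factor b a^(r+1) b, while a fresh
  -- letter after r yields a^r (Δ m) a a, which has no b.
  module Block {r} (initial-block : ∀ {t} → t < r → Δ t ≡ Δ 0) (Δr≢Δ₀ : Δ r ≢ Δ 0) where

    block-gap : ∀ {t} → t < r → gap t ≡ 0
    block-gap {zero}  _     = trans (fresh⇒gap≡ℓ λ ()) ℓ₀
    block-gap {suc t} 1+t<r = trans (repeat⇒gap-suc (trans (initial-block 1+t<r) (sym (initial-block t<r))))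
                                    (block-gap t<r)
      where
      t<r : t < r
      t<r = <-trans (n<1+n t) 1+t<r

    block-ℓ : ∀ {t} → t ≤ r → ℓ t ≡ t
    block-ℓ {zero}  _     = ℓ₀
    block-ℓ {suc t} 1+t≤r = trans (ℓ-suc t)
      (cong suc (trans (cong₂ _+_ (block-ℓ (<⇒≤ 1+t≤r)) (block-gap 1+t≤r)) (+-identityʳ t)))

    block-s : ∀ {t} → t < r → s t ≡ Δ 0
    block-s t<r =
      let j , j<r , Δj≡st = letter-in-Δ r (subst (_ <_) (sym (block-ℓ ≤-refl)) t<r)
      in trans (sym Δj≡st) (initial-block j<r)

    ℓr≡r : ℓ r ≡ r
    ℓr≡r = block-ℓ ≤-refl

    b-absent-from-copy : ∀ {j e} → ℓ j ≡ ℓ r + e → count (Δ r) (window s e r) ≡ 0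
    b-absent-from-copy ℓj≡ = count-window-absent (Δ r) s _ r λ t<r s≡Δr →
      Δr≢Δ₀ (trans (sym s≡Δr) (trans (u-suffix ℓj≡ (subst (_ <_) (sym ℓr≡r) t<r)) (block-s t<r)))

    first-return⇒b-window : 1 ≤ r → ∀ {q} → r < q → Δ q ≡ Δ 0 → (∀ {i} → r < i → i < q → Δ i ≢ Δ 0) →
                            ∃[ P ] count (Δ r) (window s P (3 + r)) ≡ 2
    first-return⇒b-window (s≤s {n = r′} z≤n) {q} r<q Δq≡a first with ℓ-split r<q
    ... | d , ℓq≡ = d , trans (count-window-sandwich b s d (suc r) (u-mirror ℓq≡) s[d+2+r]≡b) (cong (2 +_) inner)
      where
      b = Δ r
      ℓq≡r+1+d : ℓ q ≡ r + suc d
      ℓq≡r+1+d = trans ℓq≡ (cong (_+ suc d) ℓr≡r)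
      ℓq≡1+gap : ℓ q ≡ suc (ℓ r′ + gap q)
      ℓq≡1+gap = repeat-gap (<-trans (n<1+n r′) r<q) (trans (initial-block (n<1+n r′)) (sym Δq≡a)) last
        where
        last : ∀ {i} → r′ < i → i < q → Δ i ≢ Δ q
        last r′<i i<q Δi≡Δq with m≤n⇒m<n∨m≡n r′<i
        ... | inj₁ r<i  = first r<i i<q (trans Δi≡Δq Δq≡a)
        ... | inj₂ refl = Δr≢Δ₀ (trans Δi≡Δq Δq≡a)
      gap≡1+d : gap q ≡ suc d
      gap≡1+d = +-cancelˡ-≡ r′ _ _ (suc-injective (begin
        suc (r′ + gap q)    ≡⟨ cong (λ x → suc (x + gap q)) (block-ℓ (n≤1+n r′)) ⟨
        suc (ℓ r′ + gap q)  ≡⟨ ℓq≡1+gap ⟨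
        ℓ q                 ≡⟨ ℓq≡r+1+d ⟩
        r + suc d           ∎))
        where open ≡-Reasoning
      s[d+2+r]≡b : s (suc d + suc r) ≡ b
      s[d+2+r]≡b = begin
        s (suc d + suc r)   ≡⟨ cong s (trans (arith d r) (cong (_+ 1) (sym ℓq≡r+1+d))) ⟩
        s (ℓ q + 1)         ≡⟨ twin-gap-copy ℓq≡1+gap (subst (1 ≤_) (sym gap≡1+d) (s≤s z≤n)) ⟩
        s (ℓ r′ + 1)        ≡⟨ cong s (trans (cong (_+ 1) (block-ℓ (n≤1+n r′))) (+-comm r′ 1)) ⟩
        s r                 ≡⟨ cong s ℓr≡r ⟨
        s (ℓ r)             ≡⟨ s[ℓ]≡Δ r ⟩
        b                   ∎
        where
        open ≡-Reasoning
        arith : ∀ d r → suc d + suc r ≡ r + suc d + 1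
        arith = solve-∀
      s[1+d+r]≡a : s (suc d + r) ≡ Δ 0
      s[1+d+r]≡a = trans (cong (λ x → s (suc d + x)) (sym ℓr≡r)) (trans (u-suffix-end ℓq≡) Δq≡a)
      inner : count b (window s (suc d) (suc r)) ≡ 0
      inner = trans (count-window-snoc-absent b s (suc d) r λ b≡ → Δr≢Δ₀ (trans b≡ s[1+d+r]≡a))
                    (b-absent-from-copy ℓq≡)

    block-return⇒b-window : 1 ≤ r → ∀ {q} → r < q → Δ q ≡ Δ 0 → ∃[ P ] count (Δ r) (window s P (3 + r)) ≡ 2
    block-return⇒b-window 1≤r r<q Δq≡a
      with least-witness (λ q → r <? q ×-dec Δ q ≟ Δ 0) (r<q , Δq≡a)
    ... | q₀ , (r<q₀ , Δq₀≡a) , below =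
      first-return⇒b-window 1≤r r<q₀ Δq₀≡a λ r<i i<q₀ Δi≡a → below i<q₀ (r<i , Δi≡a)

    fresh-after-block⇒b-free-window : 2 ≤ r → ∀ {m} → r < m → Fresh Δ m →
                                      ∃[ P ] count (Δ r) (window s P (3 + r)) ≡ 0
    fresh-after-block⇒b-free-window 2≤r {m} r<m fresh-m with ℓ-split r<m
    ... | e , ℓm≡ = suc e , subst (λ n → count b (window s (suc e) n) ≡ 0) (+-comm r 3)
      (trans (count-window-++ b s (suc e) r 3) (cong₂ _+_ (b-absent-from-copy ℓm≡) tail))
      where
      b = Δ r
      doubling-a : ∀ {t} → t < 2 → s (suc (ℓ m + t)) ≡ Δ 0
      doubling-a t<2 = trans (fresh-doubling fresh-m (<-≤-trans t<2 (≤-trans 2≤r (≤-trans (<⇒≤ r<m) (n≤ℓ m)))))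
                             (block-s (<-≤-trans t<2 2≤r))
      ℓm≡1+e+r : suc e + r ≡ ℓ m
      ℓm≡1+e+r = trans (cong (suc e +_) (sym ℓr≡r)) (trans (+-comm (suc e) (ℓ r)) (sym ℓm≡))
      tail : count b (window s (suc e + r) 3) ≡ 0
      tail = begin
        count b (window s (suc e + r) 3)                     ≡⟨ cong (λ x → count b (window s x 3)) ℓm≡1+e+r ⟩
        count b (s (ℓ m) ∷ s (suc (ℓ m)) ∷ s (2 + ℓ m) ∷ []) ≡⟨ count-there b _ (fresh-m r<m ∘ flip trans (s[ℓ]≡Δ m)) ⟩
        count b (s (suc (ℓ m)) ∷ s (2 + ℓ m) ∷ [])           ≡⟨ count-there b _ (Δr≢Δ₀ ∘ flip trans s[1+ℓm]≡a) ⟩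
        count b (s (2 + ℓ m) ∷ [])                           ≡⟨ count-there b _ (Δr≢Δ₀ ∘ flip trans s[2+ℓm]≡a) ⟩
        0                                                    ∎
        where
        open ≡-Reasoning
        s[1+ℓm]≡a : s (suc (ℓ m)) ≡ Δ 0
        s[1+ℓm]≡a = trans (cong (s ∘ suc) (sym (+-identityʳ (ℓ m)))) (doubling-a z<s)
        s[2+ℓm]≡a : s (2 + ℓ m) ≡ Δ 0
        s[2+ℓm]≡a = trans (cong (s ∘ suc) (+-comm 1 (ℓ m))) (doubling-a (s<s z<s))

  module _ (balanced : Balanced s) where

    -- x (u i) x against (Δ 0) (Δ m) (u i), read across position ℓ m.
    fresh-recurring⇒no-later-fresh : ∀ {i m} → 1 ≤ i → Fresh Δ i → Recurs Δ i → i < m → ¬ Fresh Δ m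
    fresh-recurring⇒no-later-fresh {i} {m} 1≤i fresh-i recurs i<m fresh-m
      with fresh-recurring⇒x-u-x fresh-i recurs | m≤n⇒∃[o]m+o≡n (≤-trans 1≤i (≤-trans (<⇒≤ i<m) (n≤ℓ m)))
    ... | P , two | Q , 1+Q≡ℓm = count-gap-2⇒unbalanced x s P Q (2 + ℓ i) 0 two none balanced
      where
      x = Δ i
      sQ≡Δ₀ : s Q ≡ Δ 0
      sQ≡Δ₀ = trans (u-palindrome m Q 0 (trans (cong suc (+-identityʳ Q)) 1+Q≡ℓm)) s₀
      s[1+Q]≡Δm : s (suc Q) ≡ Δ m
      s[1+Q]≡Δm = trans (cong s 1+Q≡ℓm) (s[ℓ]≡Δ m)
      copy : ∀ {t} → t < ℓ i → s (2 + Q + t) ≡ s t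
      copy {t} t<ℓi = trans (cong (λ y → s (suc (y + t))) 1+Q≡ℓm)
                            (fresh-doubling fresh-m (<-trans t<ℓi (ℓ-strictMono i<m)))
      none : count x (window s Q (2 + ℓ i)) ≡ 0
      none = begin
        count x (window s Q (2 + ℓ i))          ≡⟨ count-there x _ (fresh-i 1≤i ∘ trans (sym sQ≡Δ₀) ∘ sym) ⟩
        count x (window s (suc Q) (suc (ℓ i)))  ≡⟨ count-there x _ (fresh-m i<m ∘ flip trans s[1+Q]≡Δm) ⟩
        count x (window s (2 + Q) (ℓ i))        ≡⟨ fresh-count-in-copy fresh-i copy ⟩
        0                                       ∎
        where open ≡-Reasoning

    -- a (u p) a against (Δ 1) a (Δ m) (u p without its last letter a), read across position ℓ m.
    initial-twice⇒no-later-fresh : Δ 1 ≢ Δ 0 → ∀ {p q m} → 1 ≤ p → p < q → Δ p ≡ Δ 0 → Δ q ≡ Δ 0 →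
                                   p < m → ¬ Fresh Δ m
    initial-twice⇒no-later-fresh Δ₁≢Δ₀ {p} {q} {m} 1≤p p<q Δp≡a Δq≡a p<m fresh-m
      with ℓ-split p<q | m≤n⇒∃[o]m+o≡n (≤-trans 1≤p (n≤ℓ p))
         | m≤n⇒∃[o]m+o≡n (≤-trans (s≤s 1≤p) (≤-trans p<m (n≤ℓ m)))
    ... | d , ℓq≡ | L , 1+L≡ℓp | Q , 2+Q≡ℓm =
      count-gap-2⇒unbalanced a s d Q (2 + ℓ p) (suc C) many few balanced
      where
      open ≡-Reasoning
      a = Δ 0
      C = count a (window s 0 L)
      0<m : 0 < m
      0<m = <-≤-trans z<s p<m
      count-u : count a (window s 0 (ℓ p)) ≡ suc C
      count-u = subst (λ n → count a (window s 0 n) ≡ suc C) 1+L≡ℓp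
        (count-window-snoc a s 0 L (trans (u-palindrome p L 0 (trans (cong suc (+-identityʳ L)) 1+L≡ℓp)) s₀))
      many : count a (window s d (2 + ℓ p)) ≡ 2 + suc C
      many = begin
        count a (window s d (2 + ℓ p))        ≡⟨ count-window-sandwich a s d (ℓ p) (trans (u-mirror ℓq≡) Δp≡a)
                                                   (trans (u-suffix-end ℓq≡) Δq≡a) ⟩
        2 + count a (window s (suc d) (ℓ p))  ≡⟨ cong (λ w → 2 + count a w)
                                                   (window-cong s s (suc d) 0 (ℓ p) (u-suffix ℓq≡)) ⟩
        2 + count a (window s 0 (ℓ p))        ≡⟨ cong (2 +_) count-u ⟩
        2 + suc C                             ∎
      sQ≡Δ₁ : s Q ≡ Δ 1
      sQ≡Δ₁ = trans (u-palindrome m Q 1 (trans (cong suc (+-comm Q 1)) 2+Q≡ℓm)) s₁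
      s[1+Q]≡a : s (suc Q) ≡ a
      s[1+Q]≡a = trans (u-palindrome m (suc Q) 0 (trans (cong (suc ∘ suc) (+-identityʳ Q)) 2+Q≡ℓm)) s₀
      s[2+Q]≡Δm : s (2 + Q) ≡ Δ m
      s[2+Q]≡Δm = trans (cong s 2+Q≡ℓm) (s[ℓ]≡Δ m)
      copy : ∀ {t} → t < L → s (3 + Q + t) ≡ s (0 + t)
      copy {t} t<L = trans (cong (λ y → s (suc (y + t))) 2+Q≡ℓm)
        (fresh-doubling fresh-m (<-trans (m<n⇒m<1+n t<L) (subst (_< ℓ m) (sym 1+L≡ℓp) (ℓ-strictMono p<m))))
      few : count a (window s Q (2 + ℓ p)) ≡ suc C
      few = begin
        count a (window s Q (2 + ℓ p))            ≡⟨ cong (λ n → count a (window s Q (2 + n))) (sym 1+L≡ℓp) ⟩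
        count a (window s Q (3 + L))              ≡⟨ count-there a _ (Δ₁≢Δ₀ ∘ trans (sym sQ≡Δ₁) ∘ sym) ⟩
        count a (window s (suc Q) (2 + L))        ≡⟨ count-here a _ (sym s[1+Q]≡a) ⟩
        suc (count a (window s (2 + Q) (suc L)))  ≡⟨ cong suc (count-there a _ (fresh-m 0<m ∘ flip trans s[2+Q]≡Δm)) ⟩
        suc (count a (window s (3 + Q) L))        ≡⟨ cong (suc ∘ count a) (window-cong s s (3 + Q) 0 L copy) ⟩
        suc C                                     ∎

    -- x (u i) x against (u i) a (Δ 1), read at the copy of u i that ends just before position ℓ p.
    fresh-recurring⇒no-first-return : ∀ {i p} → 2 ≤ i → Fresh Δ i → Recurs Δ i → i < p →
      (∀ {p′} → 0 < p′ → p′ < p → Δ p′ ≢ Δ 0) → Δ p ≢ Δ 0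
    fresh-recurring⇒no-first-return {i} {p} 2≤i fresh-i recurs i<p no-return Δp≡a
      with fresh-recurring⇒x-u-x fresh-i recurs | ℓ-split i<p
    ... | P , two | d , ℓp≡ = count-gap-2⇒unbalanced x s P (suc d) (2 + ℓ i) 0 two none balanced
      where
      open ≡-Reasoning
      x = Δ i
      0<i : 0 < i
      0<i = <-trans z<s 2≤i
      ℓp≡1+gap : ℓ p ≡ suc (ℓ 0 + gap p)
      ℓp≡1+gap = repeat-gap (<-trans 0<i i<p) (sym Δp≡a)
        λ 0<p′ p′<p Δp′≡Δp → no-return 0<p′ p′<p (trans Δp′≡Δp Δp≡a)
      1≤gap : 1 ≤ gap p
      1≤gap = s≤s⁻¹ (subst (2 ≤_) (trans ℓp≡1+gap (cong (λ y → suc (y + gap p)) ℓ₀))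
        (≤-trans 2≤i (≤-trans (<⇒≤ i<p) (n≤ℓ p))))
      s[ℓp]≡Δ₀ : s (ℓ p) ≡ Δ 0
      s[ℓp]≡Δ₀ = trans (s[ℓ]≡Δ p) Δp≡a
      s[1+ℓp]≡Δ₁ : s (suc (ℓ p)) ≡ Δ 1
      s[1+ℓp]≡Δ₁ = trans (cong s (+-comm 1 (ℓ p))) (trans (twin-gap-copy ℓp≡1+gap 1≤gap)
        (trans (cong (λ y → s (y + 1)) ℓ₀) s₁))
      tail : count x (window s (suc d + ℓ i) 2) ≡ 0
      tail = begin
        count x (window s (suc d + ℓ i) 2)      ≡⟨ cong (λ n → count x (window s n 2)) (trans (+-comm _ (ℓ i)) (sym ℓp≡)) ⟩
        count x (s (ℓ p) ∷ s (suc (ℓ p)) ∷ [])  ≡⟨ count-there x _ (fresh-i 0<i ∘ trans (sym s[ℓp]≡Δ₀) ∘ sym) ⟩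
        count x (s (suc (ℓ p)) ∷ [])            ≡⟨ count-there x _ (fresh-i 2≤i ∘ trans (sym s[1+ℓp]≡Δ₁) ∘ sym) ⟩
        0                                       ∎
      none : count x (window s (suc d) (2 + ℓ i)) ≡ 0
      none = subst (λ n → count x (window s (suc d) n) ≡ 0) (+-comm (ℓ i) 2)
        (trans (count-window-++ x s (suc d) (ℓ i) 2)
               (cong₂ _+_ (fresh-count-in-copy fresh-i (u-suffix ℓp≡)) tail))

    block-return⇒no-later-fresh : ∀ {r} → 2 ≤ r → (∀ {t} → t < r → Δ t ≡ Δ 0) → Δ r ≢ Δ 0 →
                                  ∀ {q m} → r < q → Δ q ≡ Δ 0 → r < m → ¬ Fresh Δ m
    block-return⇒no-later-fresh {r} 2≤r initial-block Δr≢Δ₀ r<q Δq≡a r<m fresh-m =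
      let P , two  = block-return⇒b-window (≤-trans (s≤s z≤n) 2≤r) r<q Δq≡a
          Q , none = fresh-after-block⇒b-free-window 2≤r r<m fresh-m
      in count-gap-2⇒unbalanced (Δ r) s P Q (3 + r) 0 two none balanced
      where open Block initial-block Δr≢Δ₀

    module _ {r c} (initial-block : ∀ {t} → t < r → Δ t ≡ Δ 0) (Δr≢Δ₀ : Δ r ≢ Δ 0)
             (r<c : r < c) (fresh-c : Fresh Δ c) where

      long-block⇒no-return : 2 ≤ r → ∀ {q} → r < q → Δ q ≢ Δ 0
      long-block⇒no-return 2≤r r<q Δq≡a =
        block-return⇒no-later-fresh 2≤r initial-block Δr≢Δ₀ r<q Δq≡a r<c fresh-c

      recurring⇒no-later-fresh : ∀ {i m} → Fresh Δ i → Δ i ≢ Δ 0 → Recurs Δ i → i < m → ¬ Fresh Δ m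
      recurring⇒no-later-fresh fresh Δi≢Δ₀ =
        fresh-recurring⇒no-later-fresh (n≢0⇒n>0 λ { refl → Δi≢Δ₀ refl }) fresh

      1≤r : 1 ≤ r
      1≤r = n≢0⇒n>0 λ { refl → Δr≢Δ₀ refl }

      returns⇒no-later-fresh : ∀ {p q m} → r < p → p < q → Δ p ≡ Δ 0 → Δ q ≡ Δ 0 → p < m → ¬ Fresh Δ m
      returns⇒no-later-fresh r<p p<q Δp≡a Δq≡a p<m with m≤n⇒m<n∨m≡n 1≤r
      ... | inj₁ 2≤r  = λ _ → long-block⇒no-return 2≤r (<-trans r<p p<q) Δq≡a
      ... | inj₂ refl = initial-twice⇒no-later-fresh Δr≢Δ₀ (<⇒≤ r<p) p<q Δp≡a Δq≡a p<m

      recurring⇒no-later-return : ∀ {i q} → Fresh Δ i → Δ i ≢ Δ 0 → Recurs Δ i → i < q → Δ q ≢ Δ 0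
      recurring⇒no-later-return {i} {q} fresh-i Δi≢a recurs i<q Δq≡a
        with m≤n⇒m<n∨m≡n (initial-block-bound Δ initial-block Δi≢a)
      ... | inj₂ refl = recurring⇒no-later-fresh fresh-i Δi≢a recurs r<c fresh-c
      ... | inj₁ r<i with m≤n⇒m<n∨m≡n 1≤r
      ...   | inj₁ 2≤r  = long-block⇒no-return 2≤r (<-trans r<i i<q) Δq≡a
      ...   | inj₂ refl with least-witness (λ p → 1 ≤? p ×-dec Δ p ≟ Δ 0) (<⇒≤ (<-trans r<i i<q) , Δq≡a)
      ...     | p , (1≤p , Δp≡a) , below with <-cmp p i
      ...       | tri< p<i _ _ = initial-twice⇒no-later-fresh Δr≢Δ₀ 1≤p (<-trans p<i i<q) Δp≡a Δq≡a p<i fresh-i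
      ...       | tri≈ _ refl _ = Δi≢a Δp≡a
      ...       | tri> _ _ i<p = fresh-recurring⇒no-first-return r<i fresh-i recurs i<p
                                   (λ 0<p′ p′<p → below p′<p ∘ (0<p′ ,_)) Δp≡a

      eventually-constant : EventuallyConstant Δ
      eventually-constant = Stabilisation.eventually-constant Δ initial-block Δr≢Δ₀
        recurring⇒no-later-fresh recurring⇒no-later-return returns⇒no-later-fresh

    three-letters⇒eventually-constant : AtLeastThreeLetters s → EventuallyConstant Δ
    three-letters⇒eventually-constant (α , β , γ , α≢β , α≢γ , β≢γ , occ-α , occ-β , occ-γ)
      with avoid-two α≢β α≢γ β≢γ (occurs⇒in-Δ occ-α) (occurs⇒in-Δ occ-β) (occurs⇒in-Δ occ-γ) (Δ 0) (Δ 0)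
    ... | _ , (j , refl) , Δj≢a , _ with least-witness (λ t → ¬? (Δ t ≟ Δ 0)) Δj≢a
    ... | r , Δr≢Δ₀ , below
      with avoid-two α≢β α≢γ β≢γ (occurs⇒in-Δ occ-α) (occurs⇒in-Δ occ-β) (occurs⇒in-Δ occ-γ) (Δ 0) (Δ r)
    ... | _ , (j′ , refl) , Δj′≢a , Δj′≢b with first-occurrence Δ j′
    ... | c , _ , Δc≡Δj′ , fresh-c = eventually-constant initial-block Δr≢Δ₀ r<c fresh-c
      where
      initial-block : ∀ {t} → t < r → Δ t ≡ Δ 0
      initial-block t<r = decidable-stable (Δ _ ≟ Δ 0) (below t<r)
      r<c : r < c
      r<c = ≤∧≢⇒< (initial-block-bound Δ initial-block (Δj′≢a ∘ trans (sym Δc≡Δj′)))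
                  λ { refl → Δj′≢b (sym Δc≡Δj′) }

balanced-standard-episturmian⇒ultimately-periodic : (s : InfWord k) → StandardEpisturmian s → Balanced s →
                                                    AtLeastThreeLetters s → UltimatelyPeriodic s
balanced-standard-episturmian⇒ultimately-periodic s (Δ , u , u₀ , closure , prefix) balanced three =
  eventually-constant⇒ultimately-periodic (three-letters⇒eventually-constant balanced three)
  where open Directive s Δ u u₀ closure prefix

sameFactors-balanced : {s t : InfWord k} → SameFactors t s → Balanced t → Balanced s
sameFactors-balanced same balanced u v u∈s v∈s =
  balanced u v (Equivalence.from (same u) u∈s) (Equivalence.from (same v) v∈s)

often-two⇒¬eventually-constant : {Δ : InfWord k} {a b : Fin k} → a ≢ b →
  OccursInfinitelyOften a Δ → OccursInfinitelyOften b Δ → ¬ EventuallyConstant Δ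
often-two⇒¬eventually-constant a≢b often-a often-b (N , constant) =
  let m , N≤m , Δm≡a = often-a N
      m′ , N≤m′ , Δm′≡b = often-b N
  in a≢b (trans (sym Δm≡a) (trans (constant N≤m) (trans (sym (constant N≤m′)) Δm′≡b)))

strict-episturmian⇒¬balanced : 3 ≤ k → (t : InfWord k) → StrictEpisturmian t → ¬ Balanced t
strict-episturmian⇒¬balanced (s≤s (s≤s (s≤s _))) _
  (s , (Δ , (u , u₀ , closure , prefix) , occurs , often) , same) balanced =
  often-two⇒¬eventually-constant 0≢1 (often _) (often _)
    (three-letters⇒eventually-constant (sameFactors-balanced same balanced) three)
  where
  open Directive s Δ u u₀ closure prefix
  0≢1 : Fin.zero ≢ Fin.suc Fin.zero
  0≢1 ()
  three : AtLeastThreeLetters s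
  three = _ , _ , _ , 0≢1 , (λ ()) , (λ ()) ,
          occurs Fin.zero , occurs (Fin.suc Fin.zero) , occurs (Fin.suc (Fin.suc Fin.zero))

corollary3p16 : (k : ℕ) →
    ((s : InfWord k) → StandardEpisturmian s → Balanced s →
       AtLeastThreeLetters s → UltimatelyPeriodic s)
    × (3 ≤ k → (t : InfWord k) → StrictEpisturmian t → ¬ Balanced t)
corollary3p16 k = balanced-standard-episturmian⇒ultimately-periodic , strict-episturmian⇒¬balanced
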